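{- Suppose $(\mathsf P,\mathsf{Opens})$ is a semitopology and $p\in \mathsf P$. Then the following are equivalent: \begin{enumerate} \item $p$ is regular, or in full: $p\in K(p)\in\mathsf{Topen}$. \item $K(p)$ is the greatest topen neighbourhood of $p$. \item $K(p)$ is a maximal topen neighbourhood of $p$. \item $p$ has a maximal topen neighbourhood. \item $p$ has some topen neighbourhood. \end{enumerate}
   Context: A semitopology is a pair $(\mathsf P,\mathsf{Opens})$ with $\mathsf{Opens}\subseteq\mathcal P(\mathsf P)$ containing $\varnothing$ and $\mathsf P$ and closed under arbitrary unions; elements of $\mathsf{Opens}$ are open sets, and an open neighbourhood of $p$ is an open set containing $p$. For sets $X,Y$ write $X\between Y$ when $X\cap Y\neq\varnothing$. A set $T\subseteq\mathsf P$ is transitive when for all $O,O'\in\mathsf{Opens}$, $O\between T$ and $T\between O'$ imply $O\between O'$; $T$ is topen when it is nonempty, open and transitive, and $\mathsf{Topen}$ denotes the set of topens. Points $p,p'$ are intertwined when every open neighbourhood of $p$ intersects every open neighbourhood of $p'$; write $p_{\between}=\{p'\in\mathsf P\mid p,p'\text{ intertwined}\}$ for the set of points intertwined with $p$. The interior $\mathrm{interior}(X)$ is the union of all open sets contained in $X$. The community of $p$ is $K(p)=\mathrm{interior}(p_{\between})$, and $p$ is regular when $p\in K(p)\in\mathsf{Topen}$. -}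

module Defs where

open import Level using (0ℓ)
open import Data.Product using (Σ; ∃; _×_; _,_)
open import Relation.Unary using (Pred; _∈_; _⊆_; _≐_; _≬_; ∅; U; Satisfiable)

-- The collection Opens ⊆ 𝒫(P) is presented as a family
-- of subsets  open : Idx → Pred Point 0ℓ  (the collection is its image).
record Semitopology : Set₁ where
  field
    Point  : Set
    Idx    : Set
    open′  : Idx → Pred Point 0ℓ
    has-∅  : Σ Idx λ i → open′ i ≐ ∅
    has-P  : Σ Idx λ i → open′ i ≐ U
    unions : (S : Pred Idx 0ℓ) →
             Σ Idx λ j → open′ j ≐ (λ x → Σ Idx λ i → S i × x ∈ open′ i)

module _ (ST : Semitopology) where
  open Semitopology ST

  IsOpen : Pred Point 0ℓ → Set
  IsOpen X = Σ Idx λ i → open′ i ≐ X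

  Transitive : Pred Point 0ℓ → Set₁
  Transitive T = (O O′ : Pred Point 0ℓ) → IsOpen O → IsOpen O′ →
                 O ≬ T → T ≬ O′ → O ≬ O′

  IsTopen : Pred Point 0ℓ → Set₁
  IsTopen T = Satisfiable T × IsOpen T × Transitive T

  Intertwined : Point → Point → Set
  Intertwined p p′ = (i j : Idx) → p ∈ open′ i → p′ ∈ open′ j →
                     open′ i ≬ open′ j

  intertwinedWith : Point → Pred Point 0ℓ
  intertwinedWith p p′ = Intertwined p p′

  interior : Pred Point 0ℓ → Pred Point 0ℓ
  interior X x = Σ Idx λ i → open′ i ⊆ X × x ∈ open′ i

  K : Point → Pred Point 0ℓ
  K p = interior (intertwinedWith p)

  Regular : Point → Set₁
  Regular p = p ∈ K p × IsTopen (K p)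

  TopenNbhd : Point → Pred Point 0ℓ → Set₁
  TopenNbhd p T = IsTopen T × p ∈ T

  GreatestTopenNbhd : Point → Pred Point 0ℓ → Set₁
  GreatestTopenNbhd p T =
    TopenNbhd p T × ((T′ : Pred Point 0ℓ) → TopenNbhd p T′ → T′ ⊆ T)

  MaximalTopenNbhd : Point → Pred Point 0ℓ → Set₁
  MaximalTopenNbhd p T =
    TopenNbhd p T × ((T′ : Pred Point 0ℓ) → TopenNbhd p T′ → T ⊆ T′ → T′ ⊆ T)

module Submission where

open import Defs
open import Data.Product using (Σ; _×_; _,_)
open import Relation.Unary using (Pred; _∈_; _⊆_; _≬_)
open import Relation.Unary.Properties using (≬-sym)
open import Function.Base using (id)
open import Function.Bundles using (_⇔_; mk⇔)
open import Level using (0ℓ)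

-- Any topen neighbourhood T of p consists of points intertwined with p, and
-- being open it lies in K(p) = interior(p_≬).  Conversely every open set meeting
-- K(p) contains a point intertwined with p and so meets T; hence transitivity
-- passes from T to K(p), which is therefore topen and the greatest topen
-- neighbourhood of p.  All five conditions then reduce to the existence of one.

module _ (ST : Semitopology) where
  open Semitopology ST

  private
    Subset = Pred Point 0ℓ

  open′-isOpen : (i : Idx) → IsOpen ST (open′ i)
  open′-isOpen i = i , id , id

  interior-⊆ : (X : Subset) → interior ST X ⊆ X
  interior-⊆ X (i , O⊆X , x∈O) = O⊆X x∈O

  interior-isOpen : (X : Subset) → IsOpen ST (interior ST X)
  interior-isOpen X with unions (λ i → open′ i ⊆ X)
  ... | j , ⊆⋃ , ⋃⊆ = j , ⊆⋃ , ⋃⊆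

  isOpen⇒⊆interior : {O X : Subset} → IsOpen ST O → O ⊆ X → O ⊆ interior ST X
  isOpen⇒⊆interior (k , k⊆O , O⊆k) O⊆X x∈O = k , (λ y∈k → O⊆X (k⊆O y∈k)) , O⊆k x∈O

  transitive⇒⊆intertwinedWith : {T : Subset} {p : Point} →
    Transitive ST T → p ∈ T → T ⊆ intertwinedWith ST p
  transitive⇒⊆intertwinedWith tr p∈T q∈T i j p∈Oᵢ q∈Oⱼ =
    tr (open′ i) (open′ j) (open′-isOpen i) (open′-isOpen j)
       (_ , p∈Oᵢ , p∈T) (_ , q∈T , q∈Oⱼ)

  ≬intertwinedWith⇒≬ : {O T : Subset} {p : Point} → IsOpen ST O → IsOpen ST T →
    p ∈ T → O ≬ intertwinedWith ST p → O ≬ T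
  ≬intertwinedWith⇒≬ (i , i⊆O , O⊆i) (k , k⊆T , T⊆k) p∈T (q , q∈O , p⋈q)
    with p⋈q k i (T⊆k p∈T) (O⊆i q∈O)
  ... | x , x∈Oₖ , x∈Oᵢ = x , i⊆O x∈Oᵢ , k⊆T x∈Oₖ

  transitive-if-≬⇒≬ : {T X : Subset} → Transitive ST T →
    ((O : Subset) → IsOpen ST O → O ≬ X → O ≬ T) → Transitive ST X
  transitive-if-≬⇒≬ tr ≬X⇒≬T O O′ isO isO′ O≬X X≬O′ =
    tr O O′ isO isO′ (≬X⇒≬T O isO O≬X) (≬-sym (≬X⇒≬T O′ isO′ (≬-sym X≬O′)))

  topenNbhd⊆K : {p : Point} {T : Subset} → TopenNbhd ST p T → T ⊆ K ST p
  topenNbhd⊆K ((_ , isT , tr) , p∈T) =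
    isOpen⇒⊆interior isT (transitive⇒⊆intertwinedWith tr p∈T)

  K-topenNbhd : {p : Point} {T : Subset} → TopenNbhd ST p T → TopenNbhd ST p (K ST p)
  K-topenNbhd {p} {T} h@((_ , isT , tr) , p∈T) =
    ((p , p∈K) , interior-isOpen _ , transitive-if-≬⇒≬ tr ≬K⇒≬T) , p∈K
    where
    p∈K : p ∈ K ST p
    p∈K = topenNbhd⊆K h p∈T

    ≬K⇒≬T : (O : Subset) → IsOpen ST O → O ≬ K ST p → O ≬ T
    ≬K⇒≬T O isO (q , q∈O , q∈K) =
      ≬intertwinedWith⇒≬ isO isT p∈T (q , q∈O , interior-⊆ _ q∈K)

  K-greatestTopenNbhd : {p : Point} {T : Subset} →
    TopenNbhd ST p T → GreatestTopenNbhd ST p (K ST p)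
  K-greatestTopenNbhd h = K-topenNbhd h , λ _ → topenNbhd⊆K

  greatest⇒maximal : {p : Point} {T : Subset} →
    GreatestTopenNbhd ST p T → MaximalTopenNbhd ST p T
  greatest⇒maximal (h , greatest) = h , λ T′ h′ _ → greatest T′ h′

theorem4p17 : (ST : Semitopology) (p : Semitopology.Point ST) →
    let open Semitopology ST in
    (Regular ST p ⇔ GreatestTopenNbhd ST p (K ST p))
    × (GreatestTopenNbhd ST p (K ST p) ⇔ MaximalTopenNbhd ST p (K ST p))
    × (MaximalTopenNbhd ST p (K ST p) ⇔ Σ (Pred Point 0ℓ) (λ T → MaximalTopenNbhd ST p T))
    × (Σ (Pred Point 0ℓ) (λ T → MaximalTopenNbhd ST p T) ⇔ Σ (Pred Point 0ℓ) (λ T → TopenNbhd ST p T))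
theorem4p17 ST p =
    mk⇔ (λ (p∈K , K-topen) → K-greatestTopenNbhd ST (K-topen , p∈K))
        (λ ((K-topen , p∈K) , _) → p∈K , K-topen)
  , mk⇔ (greatest⇒maximal ST) (λ (h , _) → K-greatestTopenNbhd ST h)
  , mk⇔ (λ m → K ST p , m)
        (λ (_ , h , _) → greatest⇒maximal ST (K-greatestTopenNbhd ST h))
  , mk⇔ (λ (T , h , _) → T , h)
        (λ (_ , h) → K ST p , greatest⇒maximal ST (K-greatestTopenNbhd ST h))
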